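{- Let $q\ge 0$ be an integer such that $8q+3$ is prime. Then \[dac\big(\overrightarrow{C}_{32q^2+24q+5}(1,2)\big)=8q+3.\]
   Context: For an integer $n$ and a set $J\subseteq\{1,\dots,n-1\}$, the circulant digraph $\overrightarrow{C}_n(J)$ has vertex set $\mathbb{Z}_n$ and arc set $\{(i,j): j-i\equiv s \pmod n \text{ for some } s\in J\}$. An acyclic vertex coloring of a digraph $D$ is one with no monochromatic directed cycle. A complete $k$-vertex-coloring of $D$ uses exactly $k$ colors and, for every ordered pair $(i,j)$ of distinct colors, there is an arc $(u,v)$ with $u$ colored $i$ and $v$ colored $j$. The diachromatic number $dac(D)$ is the largest $k$ for which $D$ has a complete acyclic $k$-vertex-coloring. -}

module Defs where

open import Data.Nat using (ℕ; zero; suc; _+_; _*_; _≤_)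
open import Data.Nat.Primality using (Prime)
open import Data.Fin using (Fin; toℕ; fromℕ)
open import Data.List using (List; _∷_; [])
open import Data.List.Membership.Propositional using (_∈_)
open import Data.Product using (Σ; ∃; ∃-syntax; _×_; _,_)
open import Relation.Nullary using (¬_)
open import Relation.Binary.PropositionalEquality using (_≡_; _≢_)
open import Function.Definitions using (Injective)

Digraph : ℕ → Set₁
Digraph n = Fin n → Fin n → Set

-- Congruence j ≡ i + s (mod n) with i,j < n written as: i + s = j + t*n for some t.
Circulant : (n : ℕ) → List ℕ → Digraph n
Circulant n J i j = Σ ℕ λ s → s ∈ J × (∃[ t ] (toℕ i + s ≡ toℕ j + t * n))

IsDirCycle : {n : ℕ} → Digraph n → (m : ℕ) → (Fin (suc (suc m)) → Fin n) → Set
IsDirCycle D m w =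
  Injective _≡_ _≡_ w
  × (∀ i j → suc (toℕ i) ≡ toℕ j → D (w i) (w j))
  × D (w (fromℕ (suc m))) (w Data.Fin.zero)

Acyclic : {n k : ℕ} → Digraph n → (Fin n → Fin k) → Set
Acyclic {n} D c = ∀ (m : ℕ) (w : Fin (suc (suc m)) → Fin n) →
  IsDirCycle D m w → ¬ (∀ i → c (w i) ≡ c (w Data.Fin.zero))

Complete : {n k : ℕ} → Digraph n → (Fin n → Fin k) → Set
Complete {n} {k} D c =
  (∀ (a : Fin k) → ∃[ u ] (c u ≡ a))
  × (∀ (a b : Fin k) → a ≢ b → ∃[ u ] ∃[ v ] (D u v × c u ≡ a × c v ≡ b))

CompleteAcyclic : {n : ℕ} → Digraph n → (k : ℕ) → Set
CompleteAcyclic {n} D k = Σ (Fin n → Fin k) λ c → Complete D c × Acyclic D c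

DacIs : {n : ℕ} → Digraph n → ℕ → Set
DacIs D k = CompleteAcyclic D k × (∀ k' → CompleteAcyclic D k' → k' ≤ k)

-- Write p = 8q + 3 = 2L + 1, so that the circulant has n = 1 + L(p + 1) vertices. Cut it into L
-- blocks of p + 1 consecutive vertices and let the colour advance by dᵢ = (i + 1)² (mod p) along
-- block i. As j runs through a block, the arcs j → j + 1 and j → j + 2 realise every pair of
-- colours whose difference is dᵢ or 2dᵢ. For p ≡ 3 (mod 8) Gauss's lemma gives 2^L ≡ -1, so by
-- Euler's criterion 2 is not a square, and then the values x² and 2x² (1 ≤ x ≤ L) exhaust the
-- nonzero residues: the colouring is complete. A directed cycle of C_n(1,2) moves in steps of 1
-- and 2, so it meets every pair {g, g + 1}; the vertices 0, 1, 2, 3 have colours 0, 1, 2, 3 and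
-- any colour misses one of the pairs {0,1}, {1,2}, {2,3}, so no cycle is monochromatic.
-- Conversely the k(k - 1) ordered pairs of colours of a complete k-colouring need distinct arcs
-- among the 2n arcs, and 2n = p² + 1 < p(p + 1) forces k ≤ p.

module Submission where

open import Defs
open import Data.Nat using (ℕ; _+_; _*_)
open import Data.Nat.Primality using (Prime)
open import Data.List using (_∷_; [])

open import Data.Empty using (⊥-elim)
open import Data.Fin using (Fin; toℕ; fromℕ<; fromℕ; punchOut; splitAt; join; combine; remQuot)
  renaming (_≟_ to _≟ᶠ_)
open import Data.Fin.Patterns using (0F; 1F)
open import Data.Fin.Permutation using (Permutation′; permutation)
open import Data.Fin.Properties using (any?; injective⇒≤; punchOut-injective; toℕ-injective; toℕ-fromℕ<; toℕ<n;
  toℕ-fromℕ; join-splitAt; splitAt-join; combine-injective; combine-remQuot)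
open import Data.List using (length)
open import Data.List.Membership.Propositional using (_∈_)
open import Data.List.Membership.Setoid.Properties using (index-injective)
open import Data.List.Relation.Unary.Any using (here; there; index)
open import Data.Nat
open import Data.Nat.Properties
open import Data.Nat.DivMod
open import Data.Nat.Divisibility using (_∣_; divides; m%n≡0⇒n∣m; n∣m⇒m%n≡0)
open import Data.Nat.Primality using (euclidsLemma; prime⇒nonZero; prime⇒nonTrivial)
open import Data.Nat.Tactic.RingSolver using (solve-∀)
open import Data.Product using (∃; ∃-syntax; _×_; _,_; proj₁; proj₂; uncurry)
open import Data.Sum as Sum using (_⊎_; inj₁; inj₂; [_,_]′)
open import Data.Sum.Properties using (inj₁-injective)
open import Function.Base using (_∘_; id)
open import Function.Definitions using (Injective)
open import Level using (0ℓ)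
open import Relation.Binary.Bundles using (Setoid)
open import Relation.Binary.Definitions using (tri<; tri≈; tri>)
open import Relation.Binary.PropositionalEquality
open import Relation.Nullary using (¬_; Dec; yes; no; map′)

open import Algebra.Properties.CommutativeSemigroup *-commutativeSemigroup using ()
  renaming (interchange to *-interchange)
open import Algebra.Properties.CommutativeSemigroup +-commutativeSemigroup using ()
  renaming (xy∙z≈xz∙y to +-right-comm; x∙yz≈y∙xz to +-left-comm)
import Algebra.Properties.CommutativeMonoid.Sum as MonoidProduct
import Relation.Binary.Reasoning.Setoid as SetoidReasoning

difference-of-squares : ∀ {x y} → x ≤ y → x * x + (y ∸ x) * (y + x) ≡ y * y
difference-of-squares {x} x≤y with m≤n⇒∃[o]m+o≡n x≤y
... | d , refl rewrite m+n∸m≡n x d = identity x d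
  where
  identity : ∀ x d → x * x + d * (x + d + x) ≡ (x + d) * (x + d)
  identity = solve-∀

^-distribʳ-* : ∀ a b n → (a * b) ^ n ≡ a ^ n * b ^ n
^-distribʳ-* a b zero = refl
^-distribʳ-* a b (suc n) = trans (cong (a * b *_) (^-distribʳ-* a b n)) (*-interchange a b (a ^ n) (b ^ n))

injective⇒surjective : ∀ {m} (f : Fin m → Fin m) → Injective _≡_ _≡_ f → ∀ y → ∃ λ x → f x ≡ y
injective⇒surjective {zero} f _ ()
injective⇒surjective {suc m} f f-inj y with any? (λ x → f x ≟ᶠ y)
... | yes hit = hit
... | no miss = ⊥-elim (1+n≰n (injective⇒≤ g-inj))
  where
  g : Fin (suc m) → Fin m
  g x = punchOut (λ y≡fx → miss (x , sym y≡fx))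
  g-inj : Injective _≡_ _≡_ g
  g-inj {x} {x'} e =
    f-inj (punchOut-injective (λ y≡fx → miss (x , sym y≡fx)) (λ y≡fx' → miss (x' , sym y≡fx')) e)

join-injective : ∀ {m l} {x y : Fin m ⊎ Fin l} → join m l x ≡ join m l y → x ≡ y
join-injective {m} {l} {x} {y} e = trans (sym (splitAt-join m l x)) (trans (cong (splitAt m) e) (splitAt-join m l y))

different : ∀ {k} (a : Fin (suc (suc k))) → ∃ λ b → a ≢ b
different a with a ≟ᶠ 0F
... | yes refl = 1F , λ ()
... | no a≢0 = 0F , a≢0

record RangeInjection (m n : ℕ) (σ : ℕ → ℕ) : Set where
  field
    maps-into : ∀ {i} → i < m → σ i < n
    injective : ∀ {i j} → i < m → j < m → σ i ≡ σ j → i ≡ j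

  restriction : Fin m → Fin n
  restriction i = fromℕ< (maps-into (toℕ<n i))

  toℕ-restriction : ∀ i → toℕ (restriction i) ≡ σ (toℕ i)
  toℕ-restriction i = toℕ-fromℕ< (maps-into (toℕ<n i))

  restriction-injective : Injective _≡_ _≡_ restriction
  restriction-injective {i} {j} e = toℕ-injective (injective (toℕ<n i) (toℕ<n j)
    (trans (sym (toℕ-restriction i)) (trans (cong toℕ e) (toℕ-restriction j))))

module _ {m σ} (inj : RangeInjection m m σ) where
  open RangeInjection inj

  private
    restriction-surjective : ∀ y → ∃ λ x → restriction x ≡ y
    restriction-surjective = injective⇒surjective restriction restriction-injective

  rangePermutation : Permutation′ m
  rangePermutation = permutation restriction (proj₁ ∘ restriction-surjective) (proj₂ ∘ restriction-surjective)
    (λ x → restriction-injective (proj₂ (restriction-surjective (restriction x))))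

  range-surjective : ∀ {y} → y < m → ∃ λ i → i < m × σ i ≡ y
  range-surjective y<m with restriction-surjective (fromℕ< y<m)
  ... | i , σi≡y =
    toℕ i , toℕ<n i , trans (sym (toℕ-restriction i)) (trans (cong toℕ σi≡y) (toℕ-fromℕ< y<m))

disjoint-injections-cover : ∀ {L f g} → RangeInjection L (L + L) f → RangeInjection L (L + L) g →
                            (∀ {i j} → i < L → j < L → f i ≢ g j) →
                            ∀ {y} → y < L + L → ∃ λ i → i < L × (f i ≡ y ⊎ g i ≡ y)
disjoint-injections-cover {L} {f} {g} F G f≢g {y} y<2L =
  preimage (injective⇒surjective σ σ-injective (fromℕ< y<2L))
  where
  module F = RangeInjection F
  module G = RangeInjection G

  both : Fin L ⊎ Fin L → Fin (L + L)
  both = [ F.restriction , G.restriction ]′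

  both-injective : Injective _≡_ _≡_ both
  both-injective {inj₁ i} {inj₁ j} e = cong inj₁ (F.restriction-injective e)
  both-injective {inj₂ i} {inj₂ j} e = cong inj₂ (G.restriction-injective e)
  both-injective {inj₁ i} {inj₂ j} e = ⊥-elim (f≢g (toℕ<n i) (toℕ<n j)
    (trans (sym (F.toℕ-restriction i)) (trans (cong toℕ e) (G.toℕ-restriction j))))
  both-injective {inj₂ i} {inj₁ j} e = ⊥-elim (f≢g (toℕ<n j) (toℕ<n i)
    (trans (sym (F.toℕ-restriction j)) (trans (cong toℕ (sym e)) (G.toℕ-restriction i))))

  σ : Fin (L + L) → Fin (L + L)
  σ k = both (splitAt L k)

  σ-injective : Injective _≡_ _≡_ σ
  σ-injective {k} {k'} e = trans (sym (join-splitAt L L k))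
    (trans (cong (join L L) (both-injective {splitAt L k} {splitAt L k'} e)) (join-splitAt L L k'))

  Goal = ∃ λ i → i < L × (f i ≡ y ⊎ g i ≡ y)

  hit : ∀ s → both s ≡ fromℕ< y<2L → Goal
  hit (inj₁ i) e =
    toℕ i , toℕ<n i , inj₁ (trans (sym (F.toℕ-restriction i)) (trans (cong toℕ e) (toℕ-fromℕ< y<2L)))
  hit (inj₂ i) e =
    toℕ i , toℕ<n i , inj₂ (trans (sym (G.toℕ-restriction i)) (trans (cong toℕ e) (toℕ-fromℕ< y<2L)))

  preimage : ∃ (λ k → σ k ≡ fromℕ< y<2L) → Goal
  preimage (k , σk≡y) = hit (splitAt L k) σk≡y

-- Products over ranges

∏ : ℕ → (ℕ → ℕ) → ℕ
∏ zero f = 1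
∏ (suc m) f = f 0 * ∏ m (f ∘ suc)

syntax ∏ m (λ i → e) = ∏[ i < m ] e

∏-cong : ∀ m {f g : ℕ → ℕ} → (∀ {i} → i < m → f i ≡ g i) → ∏ m f ≡ ∏ m g
∏-cong zero f≡g = refl
∏-cong (suc m) f≡g = cong₂ _*_ (f≡g z<s) (∏-cong m (f≡g ∘ s<s))

∏-+ : ∀ a b f → ∏ (a + b) f ≡ ∏ a f * ∏[ i < b ] f (a + i)
∏-+ zero b f = sym (+-identityʳ (∏ b f))
∏-+ (suc a) b f = trans (cong (f 0 *_) (∏-+ a b (f ∘ suc))) (sym (*-assoc (f 0) _ _))

∏-scale : ∀ m a f → ∏[ i < m ] (a * f i) ≡ a ^ m * ∏ m f
∏-scale zero a f = refl
∏-scale (suc m) a f = begin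
  a * f 0 * ∏[ i < m ] (a * f (suc i)) ≡⟨ cong (a * f 0 *_) (∏-scale m a (f ∘ suc)) ⟩
  a * f 0 * (a ^ m * ∏ m (f ∘ suc))    ≡⟨ *-interchange a (f 0) (a ^ m) _ ⟩
  a * a ^ m * (f 0 * ∏ m (f ∘ suc))    ∎
  where open ≡-Reasoning

∏-permute : ∀ {m σ} → RangeInjection m m σ → ∀ f → ∏[ i < m ] f (σ i) ≡ ∏ m f
∏-permute {m} {σ} inj f = begin
  ∏[ i < m ] f (σ i)                         ≡⟨ ∏-toℕ m (f ∘ σ) ⟨
  product {m} (f ∘ σ ∘ toℕ)                  ≡⟨ sum-cong-≗ (cong f ∘ toℕ-restriction) ⟨
  product {m} (f ∘ toℕ ∘ restriction)        ≡⟨ sum-permute (f ∘ toℕ) (rangePermutation inj) ⟨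
  product {m} (f ∘ toℕ)                      ≡⟨ ∏-toℕ m f ⟩
  ∏ m f                                      ∎
  where
  open ≡-Reasoning
  open RangeInjection inj
  open MonoidProduct *-1-commutativeMonoid renaming (sum to product)
  ∏-toℕ : ∀ m f → product {m} (f ∘ toℕ) ≡ ∏ m f
  ∏-toℕ zero f = refl
  ∏-toℕ (suc m) f = cong (f 0 *_) (∏-toℕ m (f ∘ suc))

-- Arithmetic modulo p

module Modular (p : ℕ) .{{_ : NonZero p}} where

  infix 4 _≈_ _≉_

  -- A record rather than the bare equation a % p ≡ b % p, so that a and b can be inferred.
  record _≈_ (a b : ℕ) : Set where
    constructor mk≈
    field
      %≡% : a % p ≡ b % p

  open _≈_ public

  _≉_ : ℕ → ℕ → Set
  a ≉ b = ¬ (a ≈ b)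

  ≈-setoid : Setoid 0ℓ 0ℓ
  ≈-setoid = record
    { _≈_ = _≈_
    ; isEquivalence = record
      { refl = mk≈ refl
      ; sym = λ a≈b → mk≈ (sym (%≡% a≈b))
      ; trans = λ a≈b b≈c → mk≈ (trans (%≡% a≈b) (%≡% b≈c))
      }
    }

  open Setoid ≈-setoid public using () renaming (refl to ≈-refl; sym to ≈-sym; trans to ≈-trans)

  module ≈-Reasoning = SetoidReasoning ≈-setoid

  ≉-respʳ : ∀ {x y c} → x ≉ y → c ≈ y → x ≉ c
  ≉-respʳ x≉y c≈y x≈c = x≉y (≈-trans x≈c c≈y)

  ≡⇒≈ : ∀ {a b} → a ≡ b → a ≈ b
  ≡⇒≈ a≡b = mk≈ (cong (_% p) a≡b)

  %-≈ : ∀ a → a % p ≈ a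
  %-≈ a = mk≈ (m%n%n≡m%n a p)

  0%p : 0 % p ≡ 0
  0%p = m<n⇒m%n≡m (>-nonZero⁻¹ p)

  <p⇒%≡ : ∀ {a} → a < p → a % p ≡ a
  <p⇒%≡ = m<n⇒m%n≡m

  <p-injective : ∀ {a b} → a < p → b < p → a ≈ b → a ≡ b
  <p-injective a<p b<p a≈b = trans (sym (<p⇒%≡ a<p)) (trans (%≡% a≈b) (<p⇒%≡ b<p))

  multiple≈0 : ∀ k → k * p ≈ 0
  multiple≈0 k = mk≈ (trans (m*n%n≡0 k p) (sym 0%p))

  p≈0 : p ≈ 0
  p≈0 = ≈-trans (≡⇒≈ (sym (+-identityʳ p))) (multiple≈0 1)

  +-multiple≈ : ∀ a k → a + k * p ≈ a
  +-multiple≈ a k = mk≈ ([m+kn]%n≡m%n a k p)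

  _≈?_ : ∀ a b → Dec (a ≈ b)
  a ≈? b = map′ mk≈ %≡% (a % p ≟ b % p)

  +-cong : ∀ {a b c d} → a ≈ b → c ≈ d → a + c ≈ b + d
  +-cong {a} {b} {c} {d} a≈b c≈d = mk≈ (begin
    (a + c) % p              ≡⟨ %-distribˡ-+ a c p ⟩
    (a % p + c % p) % p      ≡⟨ cong₂ (λ x y → (x + y) % p) (%≡% a≈b) (%≡% c≈d) ⟩
    (b % p + d % p) % p      ≡⟨ %-distribˡ-+ b d p ⟨
    (b + d) % p              ∎)
    where open ≡-Reasoning

  *-cong : ∀ {a b c d} → a ≈ b → c ≈ d → a * c ≈ b * d
  *-cong {a} {b} {c} {d} a≈b c≈d = mk≈ (begin
    (a * c) % p              ≡⟨ %-distribˡ-* a c p ⟩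
    (a % p * (c % p)) % p    ≡⟨ cong₂ (λ x y → (x * y) % p) (%≡% a≈b) (%≡% c≈d) ⟩
    (b % p * (d % p)) % p    ≡⟨ %-distribˡ-* b d p ⟨
    (b * d) % p              ∎)
    where open ≡-Reasoning

  +-congˡ : ∀ a {c d} → c ≈ d → a + c ≈ a + d
  +-congˡ a = +-cong (≈-refl {a})

  *-congˡ : ∀ a {c d} → c ≈ d → a * c ≈ a * d
  *-congˡ a = *-cong (≈-refl {a})

  ^-cong : ∀ {a b} k → a ≈ b → a ^ k ≈ b ^ k
  ^-cong zero a≈b = ≈-refl
  ^-cong (suc k) a≈b = *-cong a≈b (^-cong k a≈b)

  +-≈0 : ∀ a {b} → b ≈ 0 → a + b ≈ a
  +-≈0 a b≈0 = ≈-trans (+-congˡ a b≈0) (≡⇒≈ (+-identityʳ a))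

  ∏-cong-≈ : ∀ m {f g : ℕ → ℕ} → (∀ {i} → i < m → f i ≈ g i) → ∏ m f ≈ ∏ m g
  ∏-cong-≈ zero f≈g = ≈-refl
  ∏-cong-≈ (suc m) f≈g = *-cong (f≈g z<s) (∏-cong-≈ m (f≈g ∘ s<s))

  +-inverse : ∀ c → ∃ λ c' → c' + c ≈ 0
  +-inverse c = p ∸ c % p , ≈-trans (≡⇒≈ complement) (multiple≈0 (suc (c / p)))
    where
    open ≡-Reasoning
    complement : p ∸ c % p + c ≡ suc (c / p) * p
    complement = begin
      p ∸ c % p + c                      ≡⟨ cong (p ∸ c % p +_) (m≡m%n+[m/n]*n c p) ⟩
      p ∸ c % p + (c % p + c / p * p)    ≡⟨ +-assoc (p ∸ c % p) _ _ ⟨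
      p ∸ c % p + c % p + c / p * p      ≡⟨ cong (_+ c / p * p) (m∸n+n≡m (m%n≤n c p)) ⟩
      p + c / p * p                      ∎

  +-difference : ∀ a b → ∃ λ e → a + e ≈ b
  +-difference a b with +-inverse a
  ... | a' , a'+a≈0 =
    b + a' , ≈-trans (≡⇒≈ (+-left-comm a b a')) (+-≈0 b (≈-trans (≡⇒≈ (+-comm a a')) a'+a≈0))

  +-cancelˡ : ∀ {a b} c → c + a ≈ c + b → a ≈ b
  +-cancelˡ {a} {b} c c+a≈c+b with +-inverse c
  ... | c' , c'+c≈0 = begin
    a                ≈⟨ +-cong c'+c≈0 ≈-refl ⟨
    c' + c + a       ≡⟨ +-assoc c' c a ⟩
    c' + (c + a)     ≈⟨ +-congˡ c' c+a≈c+b ⟩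
    c' + (c + b)     ≡⟨ +-assoc c' c b ⟨
    c' + c + b       ≈⟨ +-cong c'+c≈0 ≈-refl ⟩
    b                ∎
    where open ≈-Reasoning

  infix 4 _≈-_

  record _≈-_ (a b : ℕ) : Set where
    constructor mk≈-
    field
      +≈0 : a + b ≈ 0

  open _≈-_ public

  opposite-*ʳ : ∀ {a a' b b'} → a ≈- a' → b ≈ b' → a * b ≈- a' * b'
  opposite-*ʳ {a} {a'} {b} {b'} (mk≈- a+a'≈0) b≈b' = mk≈- (begin
    a * b + a' * b'    ≈⟨ +-congˡ (a * b) (*-congˡ a' b≈b') ⟨
    a * b + a' * b     ≡⟨ *-distribʳ-+ b a a' ⟨
    (a + a') * b       ≈⟨ *-cong a+a'≈0 ≈-refl ⟩
    0                  ∎)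
    where open ≈-Reasoning

  opposites-* : ∀ {a a' b b'} → a ≈- a' → b ≈- b' → a * b ≈ a' * b'
  opposites-* {a} {a'} {b} {b'} a≈-a' (mk≈- b+b'≈0) = begin
    a * b                          ≈⟨ +-≈0 (a * b) (+≈0 (opposite-*ʳ a≈-a' ≈-refl)) ⟨
    a * b + (a * b' + a' * b')     ≡⟨ +-assoc (a * b) _ _ ⟨
    a * b + a * b' + a' * b'       ≡⟨ cong (_+ a' * b') (*-distribˡ-+ a b b') ⟨
    a * (b + b') + a' * b'         ≈⟨ +-cong (*-congˡ a b+b'≈0) ≈-refl ⟩
    a * 0 + a' * b'                ≡⟨ cong (_+ a' * b') (*-zeroʳ a) ⟩
    a' * b'                        ∎
    where open ≈-Reasoning

  opposite-*ˡ : ∀ {a a' b b'} → a ≈ a' → b ≈- b' → a * b ≈- a' * b'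
  opposite-*ˡ {a} {a'} {b} {b'} a≈a' b≈-b' =
    mk≈- (≈-trans (≡⇒≈ (cong₂ _+_ (*-comm a b) (*-comm a' b'))) (+≈0 (opposite-*ʳ b≈-b' a≈a')))

  ∏-odd-opposite : ∀ k {f g} → (∀ {i} → i < suc (2 * k) → f i ≈- g i) →
                   ∏ (suc (2 * k)) f ≈- ∏ (suc (2 * k)) g
  ∏-odd-opposite zero f≈-g = opposite-*ʳ (f≈-g z<s) ≈-refl
  ∏-odd-opposite (suc k) {f} {g} f≈-g = opposite-*ʳ (f≈-g z<s) (opposites-* (f≈-g (s<s z<s)) rest)
    where
    rest : ∏ (k + suc (k + 0)) (f ∘ suc ∘ suc) ≈- ∏ (k + suc (k + 0)) (g ∘ suc ∘ suc)
    rest rewrite +-suc k (k + 0) = ∏-odd-opposite k (f≈-g ∘ s<s ∘ s<s)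

module ModularPrime (p : ℕ) (prime : Prime p) where

  instance
    p-nonZero : NonZero p
    p-nonZero = prime⇒nonZero prime

  open Modular p public

  1<p : 1 < p
  1<p = nonTrivial⇒n>1 p {{prime⇒nonTrivial prime}}

  <p⇒≉0 : ∀ {a} → 0 < a → a < p → a ≉ 0
  <p⇒≉0 0<a a<p a≈0 = <⇒≢ 0<a (sym (<p-injective a<p (>-nonZero⁻¹ p) a≈0))

  1≉0 : 1 ≉ 0
  1≉0 = <p⇒≉0 z<s 1<p

  *≈0⇒≈0⊎≈0 : ∀ {a b} → a * b ≈ 0 → a ≈ 0 ⊎ b ≈ 0
  *≈0⇒≈0⊎≈0 {a} {b} ab≈0 =
    Sum.map ∣⇒≈0 ∣⇒≈0 (euclidsLemma a b prime (m%n≡0⇒n∣m (a * b) p (trans (%≡% ab≈0) 0%p)))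
    where
    ∣⇒≈0 : ∀ {x} → p ∣ x → x ≈ 0
    ∣⇒≈0 {x} p∣x = mk≈ (trans (n∣m⇒m%n≡0 x p p∣x) (sym 0%p))

  *-≉0 : ∀ {a b} → a ≉ 0 → b ≉ 0 → a * b ≉ 0
  *-≉0 a≉0 b≉0 ab≈0 = [ a≉0 , b≉0 ]′ (*≈0⇒≈0⊎≈0 ab≈0)

  ∏-≉0 : ∀ m {f} → (∀ {i} → i < m → f i ≉ 0) → ∏ m f ≉ 0
  ∏-≉0 zero f≉0 = 1≉0
  ∏-≉0 (suc m) f≉0 = *-≉0 (f≉0 z<s) (∏-≉0 m (f≉0 ∘ s<s))

  *-cancelˡ : ∀ {a x y} → a ≉ 0 → a * x ≈ a * y → x ≈ y
  *-cancelˡ {a} {x} {y} a≉0 ax≈ay =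
    [ (λ x≤y → cancel-≤ x≤y ax≈ay) , (λ y≤x → ≈-sym (cancel-≤ y≤x (≈-sym ax≈ay))) ]′ (≤-total x y)
    where
    cancel-≤ : ∀ {x y} → x ≤ y → a * x ≈ a * y → x ≈ y
    cancel-≤ {x} {y} x≤y ax≈ay with *≈0⇒≈0⊎≈0 (+-cancelˡ (a * x) (begin
      a * x + a * (y ∸ x)    ≡⟨ *-distribˡ-+ a x (y ∸ x) ⟨
      a * (x + (y ∸ x))      ≡⟨ cong (a *_) (m+[n∸m]≡n x≤y) ⟩
      a * y                  ≈⟨ ax≈ay ⟨
      a * x                  ≡⟨ +-identityʳ (a * x) ⟨
      a * x + 0              ∎))
      where open ≈-Reasoning
    ... | inj₁ a≈0 = ⊥-elim (a≉0 a≈0)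
    ... | inj₂ y∸x≈0 = ≈-sym (≈-trans (≡⇒≈ (sym (m+[n∸m]≡n x≤y))) (+-≈0 x y∸x≈0))

  affine-injection : ∀ c {d} → d ≉ 0 → RangeInjection p p (λ j → (c + j * d) % p)
  affine-injection c {d} d≉0 = record
    { maps-into = λ _ → m%n<n _ p
    ; injective = λ {i} {j} i<p j<p e → <p-injective i<p j<p
        (*-cancelˡ d≉0 (≈-trans (≡⇒≈ (*-comm d i)) (≈-trans (+-cancelˡ c (mk≈ e)) (≡⇒≈ (*-comm j d)))))
    }

  consecutive-avoiding : 2 < p → ∀ c → ∃ λ g → g ≤ 2 × g ≉ c × suc g ≉ c
  consecutive-avoiding 2<p c with c ≈? 0 | c ≈? 1
  ... | yes c≈0 | _ = 1 , s≤s z≤n , ≉-respʳ 1≉0 c≈0 , ≉-respʳ (<p⇒≉0 z<s 2<p) c≈0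
  ... | no c≉0 | yes c≈1 =
    2 , ≤-refl , ≉-respʳ (1≉0 ∘ +-cancelˡ 1) c≈1 , ≉-respʳ (<p⇒≉0 z<s 2<p ∘ +-cancelˡ 1) c≈1
  ... | no c≉0 | no c≉1 = 0 , z≤n , c≉0 ∘ ≈-sym , c≉1 ∘ ≈-sym

  residueIndex : ℕ → ℕ
  residueIndex a = pred (a % p)

  module _ {a} (a≉0 : a ≉ 0) where

    private instance
      a%p-nonZero : NonZero (a % p)
      a%p-nonZero = ≢-nonZero (λ a%p≡0 → a≉0 (mk≈ (trans a%p≡0 (sym 0%p))))

    residueIndex< : residueIndex a < pred p
    residueIndex< = pred-mono-< (m%n<n a p)

    suc-residueIndex : suc (residueIndex a) ≡ a % p
    suc-residueIndex = suc-pred (a % p)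

  residueIndex-injective : ∀ {a b} → a ≉ 0 → b ≉ 0 → residueIndex a ≡ residueIndex b → a ≈ b
  residueIndex-injective a≉0 b≉0 e =
    mk≈ (trans (sym (suc-residueIndex a≉0)) (trans (cong suc e) (suc-residueIndex b≉0)))

  <pred-p⇒suc≉0 : ∀ {i} → i < pred p → suc i ≉ 0
  <pred-p⇒suc≉0 i<p-1 = <p⇒≉0 z<s (m≤pred[n]⇒suc[m]≤n i<p-1)

  fermat : ∀ {a} → a ≉ 0 → a ^ pred p ≈ 1
  fermat {a} a≉0 = ≈-sym (*-cancelˡ (∏-≉0 (pred p) <pred-p⇒suc≉0) (begin
    W * 1                                ≡⟨ *-identityʳ W ⟩
    W                                    ≡⟨ ∏-permute σ-injection suc ⟨
    ∏[ i < pred p ] suc (σ i)            ≡⟨ ∏-cong (pred p) (suc-residueIndex ∘ a·suc≉0) ⟩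
    ∏[ i < pred p ] ((a * suc i) % p)    ≈⟨ ∏-cong-≈ (pred p) (λ _ → %-≈ _) ⟩
    ∏[ i < pred p ] (a * suc i)          ≡⟨ ∏-scale (pred p) a suc ⟩
    a ^ pred p * W                       ≡⟨ *-comm _ W ⟩
    W * a ^ pred p                       ∎))
    where
    open ≈-Reasoning
    W = ∏ (pred p) suc
    a·suc≉0 : ∀ {i} → i < pred p → a * suc i ≉ 0
    a·suc≉0 i<p-1 = *-≉0 a≉0 (<pred-p⇒suc≉0 i<p-1)
    σ : ℕ → ℕ
    σ i = residueIndex (a * suc i)
    σ-injection : RangeInjection (pred p) (pred p) σ
    σ-injection = record
      { maps-into = residueIndex< ∘ a·suc≉0
      ; injective = λ i<p-1 j<p-1 σi≡σj → suc-injective (<p-injective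
          (m≤pred[n]⇒suc[m]≤n i<p-1) (m≤pred[n]⇒suc[m]≤n j<p-1)
          (*-cancelˡ a≉0 (residueIndex-injective (a·suc≉0 i<p-1) (a·suc≉0 j<p-1) σi≡σj)))
      }

-- Quadratic residues

module Quadratic (L : ℕ) (prime : Prime (suc (2 * L))) where

  p : ℕ
  p = suc (2 * L)

  open ModularPrime p prime public

  pred-p≡L+L : pred p ≡ L + L
  pred-p≡L+L = cong (L +_) (+-identityʳ L)

  L+L<p : L + L < p
  L+L<p = s≤s (≤-reflexive (sym pred-p≡L+L))

  ≤L⇒<p : ∀ {x} → x ≤ L → x < p
  ≤L⇒<p x≤L = ≤-<-trans (≤-trans x≤L (m≤m+n L L)) L+L<p

  0<L : 0 < L
  0<L = 1<1+2L⇒0<L L 1<p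
    where
    1<1+2L⇒0<L : ∀ L → 1 < suc (2 * L) → 0 < L
    1<1+2L⇒0<L zero (s≤s ())
    1<1+2L⇒0<L (suc L) _ = z<s

  2<p : 2 < p
  2<p = s≤s (*-monoʳ-≤ 2 0<L)

  square^L≈1 : ∀ {a} → a ≉ 0 → (a * a) ^ L ≈ 1
  square^L≈1 {a} a≉0 = ≈-trans (≡⇒≈ (begin
    (a * a) ^ L        ≡⟨ cong (λ b → (a * b) ^ L) (*-identityʳ a) ⟨
    (a * (a * 1)) ^ L  ≡⟨ ^-*-assoc a 2 L ⟩
    a ^ pred p         ∎)) (fermat a≉0)
    where open ≡-Reasoning

  squares-injective : ∀ {x y} → 0 < x → x ≤ L → 0 < y → y ≤ L → x * x ≈ y * y → x ≡ y
  squares-injective {x} {y} 0<x x≤L 0<y y≤L xx≈yy =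
    [ (λ x≤y → ordered x≤y xx≈yy 0<x y≤L x≤L) , (λ y≤x → sym (ordered y≤x (≈-sym xx≈yy) 0<y x≤L y≤L)) ]′
    (≤-total x y)
    where
    ordered : ∀ {x y} → x ≤ y → x * x ≈ y * y → 0 < x → y ≤ L → x ≤ L → x ≡ y
    ordered {x} {y} x≤y xx≈yy 0<x y≤L x≤L with *≈0⇒≈0⊎≈0 {y ∸ x} {y + x} (+-cancelˡ (x * x)
        (≈-trans (≡⇒≈ (difference-of-squares x≤y)) (≈-trans (≈-sym xx≈yy) (≡⇒≈ (sym (+-identityʳ (x * x)))))))
    ... | inj₁ y∸x≈0 =
      ≤-antisym x≤y (m∸n≡0⇒m≤n (<p-injective (≤-<-trans (m∸n≤m y x) (≤L⇒<p y≤L)) (>-nonZero⁻¹ p) y∸x≈0))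
    ... | inj₂ y+x≈0 =
      ⊥-elim (<p⇒≉0 (≤-trans 0<x (m≤n+m x y)) (≤-<-trans (+-mono-≤ y≤L x≤L) L+L<p) y+x≈0)

  module _ (2^L+1≈0 : 2 ^ L + 1 ≈ 0) where

    twice-square≉square : ∀ {x y} → x ≉ 0 → y ≉ 0 → 2 * (x * x) ≉ y * y
    twice-square≉square {x} {y} x≉0 y≉0 2xx≈yy = <p⇒≉0 z<s 2<p 2≈0
      where
      open ≈-Reasoning
      2^L≈1 : 2 ^ L ≈ 1
      2^L≈1 = begin
        2 ^ L                  ≡⟨ *-identityʳ (2 ^ L) ⟨
        2 ^ L * 1              ≈⟨ *-congˡ (2 ^ L) (square^L≈1 x≉0) ⟨
        2 ^ L * (x * x) ^ L    ≡⟨ ^-distribʳ-* 2 (x * x) L ⟨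
        (2 * (x * x)) ^ L      ≈⟨ ^-cong L 2xx≈yy ⟩
        (y * y) ^ L            ≈⟨ square^L≈1 y≉0 ⟩
        1                      ∎
      2≈0 : 2 ≈ 0
      2≈0 = ≈-trans (+-cong (≈-sym 2^L≈1) ≈-refl) 2^L+1≈0

    squares-cover : ∀ {e} → e ≉ 0 → ∃ λ x → 0 < x × x ≤ L × (e ≈ x * x ⊎ e ≈ 2 * (x * x))
    squares-cover {e} e≉0 = decode (disjoint-injections-cover F G f≢g (index<L+L e≉0))
      where
      sq : ℕ → ℕ
      sq i = suc i * suc i
      suc≉0 : ∀ {i} → i < L → suc i ≉ 0
      suc≉0 i<L = <p⇒≉0 z<s (≤L⇒<p i<L)
      sq≉0 : ∀ {i} → i < L → sq i ≉ 0
      sq≉0 i<L = *-≉0 (suc≉0 i<L) (suc≉0 i<L)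
      2sq≉0 : ∀ {i} → i < L → 2 * sq i ≉ 0
      2sq≉0 i<L = *-≉0 (<p⇒≉0 z<s 2<p) (sq≉0 i<L)
      index<L+L : ∀ {a} → a ≉ 0 → residueIndex a < L + L
      index<L+L {a} a≉0 = subst (residueIndex a <_) pred-p≡L+L (residueIndex< a≉0)
      F : RangeInjection L (L + L) (λ i → residueIndex (sq i))
      F = record
        { maps-into = index<L+L ∘ sq≉0
        ; injective = λ i<L j<L e → suc-injective
            (squares-injective z<s i<L z<s j<L (residueIndex-injective (sq≉0 i<L) (sq≉0 j<L) e))
        }
      G : RangeInjection L (L + L) (λ i → residueIndex (2 * sq i))
      G = record
        { maps-into = index<L+L ∘ 2sq≉0
        ; injective = λ i<L j<L e → suc-injective (squares-injective z<s i<L z<s j<L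
            (*-cancelˡ (<p⇒≉0 z<s 2<p) (residueIndex-injective (2sq≉0 i<L) (2sq≉0 j<L) e)))
        }
      f≢g : ∀ {i j} → i < L → j < L → residueIndex (sq i) ≢ residueIndex (2 * sq j)
      f≢g i<L j<L e = twice-square≉square (suc≉0 j<L) (suc≉0 i<L)
        (≈-sym (residueIndex-injective (sq≉0 i<L) (2sq≉0 j<L) e))
      decode : ∃ (λ i → i < L × (residueIndex (sq i) ≡ residueIndex e ⊎ residueIndex (2 * sq i) ≡ residueIndex e)) →
               ∃ λ x → 0 < x × x ≤ L × (e ≈ x * x ⊎ e ≈ 2 * (x * x))
      decode (i , i<L , inj₁ e₁) = suc i , z<s , i<L , inj₁ (≈-sym (residueIndex-injective (sq≉0 i<L) e≉0 e₁))
      decode (i , i<L , inj₂ e₂) = suc i , z<s , i<L , inj₂ (≈-sym (residueIndex-injective (2sq≉0 i<L) e≉0 e₂))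

module GaussLemma (q : ℕ) (prime : Prime (suc (2 * (4 * q + 1)))) where

  open Quadratic (4 * q + 1) prime

  L : ℕ
  L = 4 * q + 1

  fold : ℕ → ℕ
  fold j with 2 * j ≤? L
  ... | yes _ = 2 * j
  ... | no _ = p ∸ 2 * j

  fold-small : ∀ {j} → 2 * j ≤ L → fold j ≡ 2 * j
  fold-small {j} 2j≤L with 2 * j ≤? L
  ... | yes _ = refl
  ... | no 2j≰L = ⊥-elim (2j≰L 2j≤L)

  fold-large : ∀ {j} → 2 * j ≰ L → fold j ≡ p ∸ 2 * j
  fold-large {j} 2j≰L with 2 * j ≤? L
  ... | yes 2j≤L = ⊥-elim (2j≰L 2j≤L)
  ... | no _ = refl

  double<p : ∀ {j} → j ≤ L → 2 * j < p
  double<p j≤L = s≤s (*-monoʳ-≤ 2 j≤L)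

  fold-range : ∀ {j} → 0 < j → j ≤ L → 0 < fold j × fold j ≤ L
  fold-range {j} 0<j j≤L with 2 * j ≤? L
  ... | yes 2j≤L = ≤-trans 0<j (m≤n*m j 2) , 2j≤L
  ... | no 2j≰L = m<n⇒0<n∸m (double<p j≤L) , (begin
    p ∸ 2 * j       ≤⟨ ∸-monoʳ-≤ p (≰⇒> 2j≰L) ⟩
    p ∸ suc L       ≡⟨ m+n∸m≡n L (L + 0) ⟩
    L + 0           ≡⟨ +-identityʳ L ⟩
    L               ∎)
    where open ≤-Reasoning

  double≢p∸double : ∀ {j j'} → j' ≤ L → 2 * j ≢ p ∸ 2 * j'
  double≢p∸double {j} {j'} j'≤L e = even≢odd (j + j') L (begin
    2 * (j + j')        ≡⟨ *-distribˡ-+ 2 j j' ⟩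
    2 * j + 2 * j'      ≡⟨ cong (_+ 2 * j') e ⟩
    p ∸ 2 * j' + 2 * j' ≡⟨ m∸n+n≡m (<⇒≤ (double<p j'≤L)) ⟩
    p                   ∎)
    where open ≡-Reasoning

  fold-injective : ∀ {j j'} → j ≤ L → j' ≤ L → fold j ≡ fold j' → j ≡ j'
  fold-injective {j} {j'} j≤L j'≤L e with 2 * j ≤? L | 2 * j' ≤? L
  ... | yes _ | yes _ = *-cancelˡ-≡ j j' 2 e
  ... | no _ | no _ = *-cancelˡ-≡ j j' 2 (∸-cancelˡ-≡ (<⇒≤ (double<p j≤L)) (<⇒≤ (double<p j'≤L)) e)
  ... | yes _ | no _ = ⊥-elim (double≢p∸double {j} j'≤L e)
  ... | no _ | yes _ = ⊥-elim (double≢p∸double {j'} j≤L (sym e))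

  fold-injection : RangeInjection L L (λ i → pred (fold (suc i)))
  fold-injection = record
    { maps-into = λ {i} i<L → ≤-trans (≤-reflexive (suc-pred _ {{fold-nonZero i<L}})) (proj₂ (fold-range z<s i<L))
    ; injective = λ {i} {j} i<L j<L e → suc-injective (fold-injective i<L j<L
        (pred-injective {{fold-nonZero i<L}} {{fold-nonZero j<L}} e))
    }
    where
    fold-nonZero : ∀ {i} → i < L → NonZero (fold (suc i))
    fold-nonZero i<L = >-nonZero (proj₁ (fold-range z<s i<L))

  ∏-fold : ∏[ i < L ] fold (suc i) ≡ ∏ L suc
  ∏-fold = trans (∏-cong L (λ i<L → sym (suc-pred _ {{>-nonZero (proj₁ (fold-range z<s i<L))}})))
                 (∏-permute fold-injection suc)

  -- 2j ≤ L exactly for j ≤ 2q, so the last 2q + 1 factors change sign when folded.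
  ∏-double≈-∏-fold : ∏[ i < L ] (2 * suc i) ≈- ∏[ i < L ] fold (suc i)
  ∏-double≈-∏-fold = subst₂ _≈-_ (sym (split (λ i → 2 * suc i))) (sym (split (λ i → fold (suc i))))
    (opposite-*ˡ (≡⇒≈ (∏-cong (2 * q) small)) (∏-odd-opposite q large))
    where
    L≡ : ∀ q → 4 * q + 1 ≡ 2 * q + suc (2 * q)
    L≡ = solve-∀
    split : ∀ h → ∏ L h ≡ ∏ (2 * q) h * ∏[ i < suc (2 * q) ] h (2 * q + i)
    split h = trans (cong (λ m → ∏ m h) (L≡ q)) (∏-+ (2 * q) (suc (2 * q)) h)
    small : ∀ {i} → i < 2 * q → 2 * suc i ≡ fold (suc i)
    small {i} i<2q =
      sym (fold-small {suc i} (≤-trans (*-monoʳ-≤ 2 i<2q) (≤-trans (≤-reflexive (4q≡ q)) (m≤m+n (4 * q) 1))))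
      where
      4q≡ : ∀ q → 2 * (2 * q) ≡ 4 * q
      4q≡ = solve-∀
    large : ∀ {i} → i < suc (2 * q) → 2 * suc (2 * q + i) ≈- fold (suc (2 * q + i))
    large {i} i<2q+1 = subst (2 * suc (2 * q + i) ≈-_) (sym (fold-large {suc (2 * q + i)} (<⇒≱ L<2j)))
      (mk≈- (≈-trans (≡⇒≈ (m+[n∸m]≡n (<⇒≤ (double<p j≤L)))) p≈0))
      where
      j≤L : suc (2 * q + i) ≤ L
      j≤L = ≤-trans (≤-reflexive (sym (+-suc (2 * q) i)))
                    (≤-trans (+-monoʳ-≤ (2 * q) i<2q+1) (≤-reflexive (sym (L≡ q))))
      L<2j : L < 2 * suc (2 * q + i)
      L<2j = ≤-trans (≤-reflexive (2q+1≡ q)) (*-monoʳ-≤ 2 (s≤s (m≤m+n (2 * q) i)))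
        where
        2q+1≡ : ∀ q → suc (4 * q + 1) ≡ 2 * suc (2 * q)
        2q+1≡ = solve-∀

  2^L+1≈0 : 2 ^ L + 1 ≈ 0
  2^L+1≈0 = [ id , ⊥-elim ∘ W≉0 ]′ (*≈0⇒≈0⊎≈0 (begin
    (2 ^ L + 1) * W                                    ≡⟨ *-distribʳ-+ W (2 ^ L) 1 ⟩
    2 ^ L * W + 1 * W                                  ≡⟨ cong₂ _+_ (∏-scale L 2 suc) (trans ∏-fold (sym (*-identityˡ W))) ⟨
    ∏[ i < L ] (2 * suc i) + ∏[ i < L ] fold (suc i)   ≈⟨ +≈0 ∏-double≈-∏-fold ⟩
    0                                                  ∎))
    where
    open ≈-Reasoning
    W = ∏ L suc
    W≉0 : W ≉ 0
    W≉0 = ∏-≉0 L (λ i<L → <p⇒≉0 z<s (≤L⇒<p i<L))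

-- Directed cycles and complete colourings

module _ {n} {D : Digraph n} (P : Fin n → Set) (rank : Fin n → ℕ)
         (rank-increases : ∀ {u v} → P u → D u v → rank u < rank v) where

  no-cycle-within : ∀ m w → IsDirCycle D m w → ¬ (∀ i → P (w i))
  no-cycle-within m w (_ , arcs , closing) all-P = m+n≮n (suc m) (rank (w 0F)) final
    where
    grows : ∀ k (k<2+m : k < suc (suc m)) → k + rank (w 0F) ≤ rank (w (fromℕ< k<2+m))
    grows zero _ = ≤-refl
    grows (suc k) k+1<2+m = ≤-trans (s≤s (grows k k<2+m)) (rank-increases (all-P _) (arcs _ _ successor))
      where
      k<2+m = <-trans (n<1+n k) k+1<2+m
      successor : suc (toℕ (fromℕ< k<2+m)) ≡ toℕ (fromℕ< k+1<2+m)
      successor = trans (cong suc (toℕ-fromℕ< k<2+m)) (sym (toℕ-fromℕ< k+1<2+m))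
    last≡ : fromℕ< (n<1+n (suc m)) ≡ fromℕ (suc m)
    last≡ = toℕ-injective (trans (toℕ-fromℕ< (n<1+n (suc m))) (sym (toℕ-fromℕ (suc m))))
    final : suc m + rank (w 0F) < rank (w 0F)
    final = ≤-<-trans (subst (λ i → suc m + rank (w 0F) ≤ rank (w i)) last≡ (grows (suc m) (n<1+n (suc m))))
                      (rank-increases (all-P _) closing)

pairs⇒surjective : ∀ {n k} {D : Digraph n} {c : Fin n → Fin k} → 1 < k →
                   (∀ a b → a ≢ b → ∃[ u ] ∃[ v ] (D u v × c u ≡ a × c v ≡ b)) → ∀ a → ∃[ u ] (c u ≡ a)
pairs⇒surjective {k = suc zero} (s≤s ()) _ _
pairs⇒surjective {k = suc (suc _)} _ pairs a with different a
... | b , a≢b with pairs a b a≢b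
... | u , _ , _ , cu≡a , _ = u , cu≡a

module CirculantArcs (n : ℕ) .{{_ : NonZero n}} where

  open Modular n

  arc-≈ : ∀ {J u v} (arc : Circulant n J u v) → toℕ u + proj₁ arc ≈ toℕ v
  arc-≈ {v = v} (_ , _ , t , u+s≡v+tn) = ≈-trans (≡⇒≈ u+s≡v+tn) (+-multiple≈ (toℕ v) t)

  congruent-vertices : ∀ {x} {v v' : Fin n} → x ≈ toℕ v → x ≈ toℕ v' → v ≡ v'
  congruent-vertices {v = v} {v'} x≈v x≈v' =
    toℕ-injective (<p-injective (toℕ<n v) (toℕ<n v') (≈-trans (≈-sym x≈v) x≈v'))

step∈1,2 : ∀ {s} → s ∈ 1 ∷ 2 ∷ [] → 1 ≤ s × s ≤ 2
step∈1,2 (here refl) = s≤s z≤n , s≤s z≤n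
step∈1,2 (there (here refl)) = s≤s z≤n , s≤s (s≤s z≤n)

module CirculantCycles {n g} (2+g≤n : 2 + g ≤ n) where

  private instance
    n-nonZero : NonZero n
    n-nonZero = >-nonZero (≤-trans (s≤s z≤n) 2+g≤n)

  open Modular n
  open CirculantArcs n

  Avoids : Fin n → Set
  Avoids u = toℕ u ≢ g × toℕ u ≢ suc g

  shift : ℕ
  shift = n ∸ (2 + g)

  -- The position of u counted from g + 2; only arcs leaving g or g + 1 can wrap around.
  rank : Fin n → ℕ
  rank u = (toℕ u + shift) % n

  rank-room : ∀ {u} → Avoids u → rank u + 2 < n
  rank-room {u} (u≢g , u≢1+g) with <-cmp (toℕ u) g
  ... | tri< u<g _ _ = begin-strict
    rank u + 2               ≡⟨ cong (_+ 2) (m<n⇒m%n≡m (≤-<-trans (m≤m+n _ 2) below)) ⟩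
    toℕ u + shift + 2        <⟨ below ⟩
    n                        ∎
    where
    open ≤-Reasoning
    below : toℕ u + shift + 2 < n
    below = begin-strict
      toℕ u + shift + 2      ≡⟨ +-assoc (toℕ u) shift 2 ⟩
      toℕ u + (shift + 2)    ≡⟨ cong (toℕ u +_) (+-comm shift 2) ⟩
      toℕ u + (2 + shift)    ≡⟨ +-assoc (toℕ u) 2 shift ⟨
      toℕ u + 2 + shift      <⟨ +-monoˡ-< shift (+-monoˡ-< 2 u<g) ⟩
      g + 2 + shift          ≡⟨ cong (_+ shift) (+-comm g 2) ⟩
      2 + g + shift          ≡⟨ m+[n∸m]≡n 2+g≤n ⟩
      n                      ∎
  ... | tri≈ _ u≡g _ = ⊥-elim (u≢g u≡g)
  ... | tri> _ _ g<u = begin-strict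
    rank u + 2                       ≡⟨ cong (λ x → x % n + 2) wrap ⟩
    (toℕ u ∸ (2 + g) + n) % n + 2    ≡⟨ cong (_+ 2) ([m+n]%n≡m%n _ n) ⟩
    (toℕ u ∸ (2 + g)) % n + 2        ≡⟨ cong (_+ 2) (m<n⇒m%n≡m (≤-<-trans (m∸n≤m (toℕ u) (2 + g)) (toℕ<n u))) ⟩
    toℕ u ∸ (2 + g) + 2      ≤⟨ +-monoˡ-≤ 2 (∸-monoʳ-≤ (toℕ u) (m≤m+n 2 g)) ⟩
    toℕ u ∸ 2 + 2            ≡⟨ m∸n+n≡m (≤-trans (m≤m+n 2 g) 2+g≤u) ⟩
    toℕ u                    <⟨ toℕ<n u ⟩
    n                        ∎
    where
    open ≤-Reasoning
    2+g≤u : 2 + g ≤ toℕ u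
    2+g≤u = ≤∧≢⇒< g<u (u≢1+g ∘ sym)
    wrap : toℕ u + shift ≡ toℕ u ∸ (2 + g) + n
    wrap = begin-equality
      toℕ u + shift                      ≡⟨ cong (_+ shift) (m∸n+n≡m 2+g≤u) ⟨
      toℕ u ∸ (2 + g) + (2 + g) + shift  ≡⟨ +-assoc (toℕ u ∸ (2 + g)) _ _ ⟩
      toℕ u ∸ (2 + g) + (2 + g + shift)  ≡⟨ cong (toℕ u ∸ (2 + g) +_) (m+[n∸m]≡n 2+g≤n) ⟩
      toℕ u ∸ (2 + g) + n                ∎

  rank-increases : ∀ {u v} → Avoids u → Circulant n (1 ∷ 2 ∷ []) u v → rank u < rank v
  rank-increases {u} {v} avoids arc@(s , s∈J , _) =
    subst (rank u <_) (sym rank-v≡) (m<m+n (rank u) (proj₁ (step∈1,2 s∈J)))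
    where
    rank-v≡ : rank v ≡ rank u + s
    rank-v≡ = <p-injective (m%n<n _ n) (≤-<-trans (+-monoʳ-≤ (rank u) (proj₂ (step∈1,2 s∈J))) (rank-room avoids)) (begin
      rank v                ≈⟨ %-≈ (toℕ v + shift) ⟩
      toℕ v + shift         ≈⟨ +-cong (arc-≈ arc) ≈-refl ⟨
      toℕ u + s + shift     ≡⟨ +-assoc (toℕ u) s shift ⟩
      toℕ u + (s + shift)   ≡⟨ cong (toℕ u +_) (+-comm s shift) ⟩
      toℕ u + (shift + s)   ≡⟨ +-assoc (toℕ u) shift s ⟨
      toℕ u + shift + s     ≈⟨ +-cong (%-≈ (toℕ u + shift)) ≈-refl ⟨
      rank u + s            ∎)
      where open ≈-Reasoning

  cycle-meets : ∀ m w → IsDirCycle (Circulant n (1 ∷ 2 ∷ [])) m w → ¬ (∀ i → Avoids (w i))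
  cycle-meets = no-cycle-within Avoids rank rank-increases

module _ {n k J} .{{_ : NonZero n}} {c : Fin n → Fin k} (complete : Complete (Circulant n J) c) where

  open Modular n
  open CirculantArcs n

  ColouredArc : Fin k → Fin k → Set
  ColouredArc a b = ∃ λ u → ∃ λ v → Circulant n J u v × c u ≡ a × c v ≡ b

  arcCode : ∀ {a b} → ColouredArc a b → Fin (length J * n)
  arcCode (u , _ , (_ , s∈J , _) , _) = combine (index s∈J) u

  arcCode-injective : ∀ {a b a' b'} (x : ColouredArc a b) (y : ColouredArc a' b') →
                      arcCode x ≡ arcCode y → a ≡ a' × b ≡ b'
  arcCode-injective (u , v , arc@(s , s∈J , _) , refl , refl) (u' , v' , arc'@(s' , s'∈J , _) , refl , refl) codes≡
    with combine-injective (index s∈J) u (index s'∈J) u' codes≡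
  ... | i≡i' , refl with index-injective (setoid ℕ) s∈J s'∈J i≡i'
  ... | refl = refl , cong c (congruent-vertices (arc-≈ arc) (arc-≈ arc'))

  pairCode : Fin k × Fin k → Fin (length J * n) ⊎ Fin k
  pairCode (a , b) with a ≟ᶠ b
  ... | yes _ = inj₂ a
  ... | no a≢b = inj₁ (arcCode (proj₂ complete a b a≢b))

  pairCode-injective : Injective _≡_ _≡_ pairCode
  pairCode-injective {a , b} {a' , b'} e with a ≟ᶠ b | a' ≟ᶠ b' | e
  ... | yes refl | yes refl | refl = refl
  ... | no a≢b | no a'≢b' | codes≡
    with arcCode-injective (proj₂ complete a b a≢b) (proj₂ complete a' b' a'≢b') (inj₁-injective codes≡)
  ...   | refl , refl = refl

  complete-colouring-bound : k * k ≤ length J * n + k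
  complete-colouring-bound = injective⇒≤ {f = join _ _ ∘ pairCode ∘ remQuot k} λ {x} {y} e →
    trans (sym (combine-remQuot {k} k x)) (trans
      (cong (uncurry combine) (pairCode-injective (join-injective {x = pairCode (remQuot k x)} {pairCode (remQuot k y)} e)))
      (combine-remQuot {k} k y))

-- The colouring

module WalkColouring (p : ℕ) (prime : Prime p) (L : ℕ) (d : ℕ → ℕ) where

  open ModularPrime p prime

  B : ℕ
  B = suc p

  n : ℕ
  n = suc (L * B)

  offset : ℕ → ℕ
  offset zero = 0
  offset (suc i) = offset i + d i

  colourℕ : ℕ → ℕ
  colourℕ x = offset (x / B) + x % B * d (x / B)

  colour : Fin n → Fin p
  colour u = colourℕ (toℕ u) mod p

  colour-≡ : ∀ {u a} → colourℕ (toℕ u) ≈ toℕ a → colour u ≡ a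
  colour-≡ {u} {a} u≈a = toℕ-injective (trans (toℕ-fromℕ< _) (trans (%≡% u≈a) (<p⇒%≡ (toℕ<n a))))

  colourℕ-block : ∀ i {j} → j < B → colourℕ (j + i * B) ≡ offset i + j * d i
  colourℕ-block i {j} j<B = cong₂ (λ i' j' → offset i' + j' * d i') block position
    where
    block : (j + i * B) / B ≡ i
    block = trans (+-distrib-/-∣ʳ j (divides i refl)) (cong₂ _+_ (m<n⇒m/n≡0 j<B) (m*n/n≡m i B))
    position : (j + i * B) % B ≡ j
    position = trans ([m+kn]%n≡m%n j i B) (m<n⇒m%n≡m j<B)

  -- At j = B this is the first vertex of block i + 1, whose colour fits because B ≡ 1 (mod p).
  colourℕ-block-end : ∀ i {j} → j ≤ B → colourℕ (j + i * B) ≈ offset i + j * d i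
  colourℕ-block-end i j≤B with m≤n⇒m<n∨m≡n j≤B
  ... | inj₁ j<B = ≡⇒≈ (colourℕ-block i j<B)
  ... | inj₂ refl = begin
    colourℕ (B + i * B)           ≡⟨ colourℕ-block (suc i) z<s ⟩
    offset i + d i + 0            ≡⟨ +-identityʳ _ ⟩
    offset i + d i                ≈⟨ +-≈0 _ (multiple≈0 (d i)) ⟨
    offset i + d i + d i * p      ≡⟨ +-assoc (offset i) (d i) _ ⟩
    offset i + (d i + d i * p)    ≡⟨ cong (λ x → offset i + (d i + x)) (*-comm (d i) p) ⟩
    offset i + B * d i            ∎
    where open ≈-Reasoning

  position< : ∀ {i j} → i < L → j ≤ B → j + i * B < n
  position< {i} {j} i<L j≤B = s≤s (≤-trans (+-monoˡ-≤ (i * B) j≤B) (*-monoˡ-≤ B i<L))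

  vertex : ∀ {i j} → i < L → j ≤ B → Fin n
  vertex i<L j≤B = fromℕ< (position< i<L j≤B)

  toℕ-vertex : ∀ {i j} (i<L : i < L) (j≤B : j ≤ B) → toℕ (vertex i<L j≤B) ≡ j + i * B
  toℕ-vertex i<L j≤B = toℕ-fromℕ< (position< i<L j≤B)

  step-arc : ∀ {i j s} → i < L → j < p → s ∈ 1 ∷ 2 ∷ [] →
             ∃[ u ] ∃[ v ] (Circulant n (1 ∷ 2 ∷ []) u v ×
                            colourℕ (toℕ u) ≈ offset i + j * d i × colourℕ (toℕ v) ≈ offset i + j * d i + s * d i)
  step-arc {i} {j} {s} i<L j<p s∈ = u , v , (s , s∈ , 0 , arc) , u-colour , v-colour
    where
    j≤B : j ≤ B
    j≤B = m≤n⇒m≤1+n (<⇒≤ j<p)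
    j+s≤B : j + s ≤ B
    j+s≤B = ≤-trans (+-monoʳ-≤ j (proj₂ (step∈1,2 s∈))) (≤-trans (≤-reflexive (+-comm j 2)) (s≤s j<p))
    u = vertex i<L j≤B
    v = vertex i<L j+s≤B
    arc : toℕ u + s ≡ toℕ v + 0
    arc = begin
      toℕ u + s        ≡⟨ cong (_+ s) (toℕ-vertex i<L j≤B) ⟩
      j + i * B + s    ≡⟨ +-right-comm j (i * B) s ⟩
      j + s + i * B    ≡⟨ toℕ-vertex i<L j+s≤B ⟨
      toℕ v            ≡⟨ +-identityʳ (toℕ v) ⟨
      toℕ v + 0        ∎
      where open ≡-Reasoning
    u-colour : colourℕ (toℕ u) ≈ offset i + j * d i
    u-colour = ≈-trans (≡⇒≈ (cong colourℕ (toℕ-vertex i<L j≤B))) (colourℕ-block-end i j≤B)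
    v-colour : colourℕ (toℕ v) ≈ offset i + j * d i + s * d i
    v-colour = begin
      colourℕ (toℕ v)                  ≡⟨ cong colourℕ (toℕ-vertex i<L j+s≤B) ⟩
      colourℕ (j + s + i * B)          ≈⟨ colourℕ-block-end i j+s≤B ⟩
      offset i + (j + s) * d i         ≡⟨ cong (offset i +_) (*-distribʳ-+ (d i) j s) ⟩
      offset i + (j * d i + s * d i)   ≡⟨ +-assoc (offset i) _ _ ⟨
      offset i + j * d i + s * d i     ∎
      where open ≈-Reasoning

  CoveredBySteps : Set
  CoveredBySteps = ∀ {e} → e ≉ 0 → ∃ λ i → i < L × (e ≈ d i ⊎ e ≈ 2 * d i)

  colour-pairs : CoveredBySteps → ∀ a b → a ≢ b →
                 ∃[ u ] ∃[ v ] (Circulant n (1 ∷ 2 ∷ []) u v × colour u ≡ a × colour v ≡ b)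
  colour-pairs covered a b a≢b with +-difference (toℕ a) (toℕ b)
  ... | e , a+e≈b = from-step (covered e≉0)
    where
    e≉0 : e ≉ 0
    e≉0 e≈0 =
      a≢b (toℕ-injective (<p-injective (toℕ<n a) (toℕ<n b) (≈-trans (≈-sym (+-≈0 (toℕ a) e≈0)) a+e≈b)))
    as-step : ∀ {x} → e ≈ x ⊎ e ≈ 2 * x → ∃ λ s → s ∈ 1 ∷ 2 ∷ [] × e ≈ s * x
    as-step (inj₁ e≈x) = 1 , here refl , ≈-trans e≈x (≡⇒≈ (sym (+-identityʳ _)))
    as-step (inj₂ e≈2x) = 2 , there (here refl) , e≈2x
    step≉0 : ∀ {s x} → e ≈ s * x → x ≉ 0
    step≉0 {s} e≈sx x≈0 = e≉0 (≈-trans e≈sx (≈-trans (*-congˡ s x≈0) (≡⇒≈ (*-zeroʳ s))))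
    Goal = ∃[ u ] ∃[ v ] (Circulant n (1 ∷ 2 ∷ []) u v × colour u ≡ a × colour v ≡ b)
    from-arc : ∀ {i j s} → i < L → j < p → s ∈ 1 ∷ 2 ∷ [] → offset i + j * d i ≈ toℕ a → e ≈ s * d i → Goal
    from-arc {i} {j} {s} i<L j<p s∈ start≈a e≈sd with step-arc i<L j<p s∈
    ... | u , v , arc , u-colour , v-colour =
      u , v , arc , colour-≡ {u} (≈-trans u-colour start≈a) , colour-≡ {v} (begin
      colourℕ (toℕ v)                  ≈⟨ v-colour ⟩
      offset i + j * d i + s * d i     ≈⟨ +-cong start≈a (≈-sym e≈sd) ⟩
      toℕ a + e                        ≈⟨ a+e≈b ⟩
      toℕ b                            ∎)
      where open ≈-Reasoning
    from-step : (∃ λ i → i < L × (e ≈ d i ⊎ e ≈ 2 * d i)) → Goal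
    from-step (i , i<L , e≈) with as-step e≈
    ... | s , s∈ , e≈sd with range-surjective (affine-injection (offset i) (step≉0 {s} e≈sd)) (toℕ<n a)
    ... | j , j<p , start≡a = from-arc i<L j<p s∈ (mk≈ (trans start≡a (sym (<p⇒%≡ (toℕ<n a))))) e≈sd

  colourℕ-first-block : d 0 ≡ 1 → ∀ {x} → x < B → colourℕ x ≡ x
  colourℕ-first-block d₀≡1 {x} x<B = begin
    colourℕ x          ≡⟨ cong colourℕ (+-identityʳ x) ⟨
    colourℕ (x + 0)    ≡⟨ colourℕ-block 0 x<B ⟩
    x * d 0            ≡⟨ cong (x *_) d₀≡1 ⟩
    x * 1              ≡⟨ *-identityʳ x ⟩
    x                  ∎
    where open ≡-Reasoning

  colour-acyclic : d 0 ≡ 1 → 0 < L → 2 < p → Acyclic (Circulant n (1 ∷ 2 ∷ [])) colour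
  colour-acyclic d₀≡1 0<L 2<p m w cycle monochromatic with consecutive-avoiding 2<p (toℕ (colour (w 0F)))
  ... | g , g≤2 , g≉c , 1+g≉c = CirculantCycles.cycle-meets 2+g≤n m w cycle
    (λ i → avoids i (≤-trans (s≤s g≤2) (≤-trans (n≤1+n 3) 4≤B)) g≉c ,
           avoids i (≤-trans (s≤s (s≤s g≤2)) 4≤B) 1+g≉c)
    where
    4≤B : 4 ≤ B
    4≤B = s≤s 2<p
    2+g≤n : 2 + g ≤ n
    2+g≤n = ≤-trans (s≤s (s≤s g≤2)) (≤-trans 4≤B (≤-trans (m≤n*m B L {{>-nonZero 0<L}}) (n≤1+n _)))
    avoids : ∀ i {x} → x < B → x ≉ toℕ (colour (w 0F)) → toℕ (w i) ≢ x
    avoids i {x} x<B x≉c wᵢ≡x = x≉c (mk≈ (begin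
      x % p                        ≡⟨ cong (_% p) (colourℕ-first-block d₀≡1 x<B) ⟨
      colourℕ x % p                ≡⟨ cong (λ y → colourℕ y % p) wᵢ≡x ⟨
      colourℕ (toℕ (w i)) % p      ≡⟨ toℕ-fromℕ< _ ⟨
      toℕ (colour (w i))           ≡⟨ cong toℕ (monochromatic i) ⟩
      toℕ (colour (w 0F))          ≡⟨ <p⇒%≡ (toℕ<n _) ⟨
      toℕ (colour (w 0F)) % p      ∎))
      where open ≡-Reasoning

module _ (L : ℕ) (prime : Prime (suc (2 * L))) where

  open Quadratic L prime
  open WalkColouring p prime L (λ i → suc i * suc i)

  too-many-colours : ∀ {k} → suc p ≤ k → 2 * n + k < k * k
  too-many-colours {k} p<k = begin-strict
    2 * n + k             <⟨ +-monoˡ-< k (m<m+n (2 * n) (*-monoʳ-< 2 0<L)) ⟩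
    2 * n + 2 * L + k     ≡⟨ cong (_+ k) (identity L) ⟨
    suc p * p + k         ≤⟨ +-monoˡ-≤ k (*-monoˡ-≤ p p<k) ⟩
    k * p + k             ≡⟨ +-comm (k * p) k ⟩
    k + k * p             ≡⟨ *-suc k p ⟨
    k * suc p             ≤⟨ *-monoʳ-≤ k p<k ⟩
    k * k                 ∎
    where
    open ≤-Reasoning
    identity : ∀ L → suc (suc (2 * L)) * suc (2 * L) ≡ 2 * suc (L * suc (suc (2 * L))) + 2 * L
    identity = solve-∀

  dac-circulant : 2 ^ L + 1 ≈ 0 → DacIs (Circulant n (1 ∷ 2 ∷ [])) p
  dac-circulant 2^L+1≈0 = (colour , (surjective , pairs) , colour-acyclic refl 0<L 2<p) , maximal
    where
    pairs = colour-pairs λ e≉0 → steps (squares-cover 2^L+1≈0 e≉0)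
      where
      steps : ∀ {e} → (∃ λ x → 0 < x × x ≤ L × (e ≈ x * x ⊎ e ≈ 2 * (x * x))) →
              ∃ λ i → i < L × (e ≈ suc i * suc i ⊎ e ≈ 2 * (suc i * suc i))
      steps (suc i , _ , i<L , e≈) = i , i<L , e≈
    surjective = pairs⇒surjective 1<p pairs
    maximal : ∀ k → CompleteAcyclic (Circulant n (1 ∷ 2 ∷ [])) k → k ≤ p
    maximal k (_ , complete , _) with k ≤? p
    ... | yes k≤p = k≤p
    ... | no k≰p = ⊥-elim (<⇒≱ (too-many-colours (≰⇒> k≰p)) (complete-colouring-bound complete))

corollary6 : (q : ℕ) → Prime (8 * q + 3) →
    DacIs (Circulant (32 * q * q + 24 * q + 5) (1 ∷ 2 ∷ [])) (8 * q + 3)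
corollary6 q is-prime = subst₂ (λ n k → DacIs (Circulant n (1 ∷ 2 ∷ [])) k) (vertices q) (sym (modulus q))
  (dac-circulant (4 * q + 1) prime' (GaussLemma.2^L+1≈0 q prime'))
  where
  modulus : ∀ q → 8 * q + 3 ≡ suc (2 * (4 * q + 1))
  modulus = solve-∀
  vertices : ∀ q → suc ((4 * q + 1) * suc (suc (2 * (4 * q + 1)))) ≡ 32 * q * q + 24 * q + 5
  vertices = solve-∀
  prime' = subst Prime (modulus q) is-prime
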